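{- Let $0<\alpha<1$ and $A=1+\lfloor 1/\alpha\rfloor$. Suppose $S$ is partitioned into contiguous pieces such that either there is a single piece, or every piece contains between $A$ and $3A$ distinct symbols. Let $[l..r]$ be a range. (1) If $S[l..r]$ overlaps only one or two pieces and $S[l..r]$ has an $\alpha$-minority, then this $\alpha$-minority is one of the distinct symbols of those overlapped pieces. (2) If $S[l..r]$ entirely contains a piece that is not the last piece of $S$, then one of the distinct symbols of that contained piece is an $\alpha$-minority of $S[l..r]$.
   Context: $S[1..n]$ is a sequence. An $\alpha$-minority of $S[l..r]$ is a symbol that occurs at least once but not more than $\alpha(r-l+1)$ times in $S[l..r]$. A piece is overlapped by $S[l..r]$ if it shares at least one position with $[l..r]$, and contained in it if all its positions lie in $[l..r]$.
   Formalization: The parameter α ranges over the rationals with $0<\alpha<1$ rather than over all reals in that interval. -}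

module Defs where

open import Data.Nat using (ℕ; zero; suc; _+_; _*_; _∸_; _≤_; _<_; NonZero)
open import Data.Nat.DivMod using (_/_)
open import Data.Nat.Properties using (_≟_)
open import Data.List using (List; map; upTo; filter; length; deduplicate)
open import Data.Product using (Σ; ∃; _×_)
open import Relation.Binary.PropositionalEquality using (_≡_)

-- A sequence is a function S : ℕ → ℕ (symbols are naturals) together with a
-- length n; only positions 0 .. n-1 are meaningful (0-indexed positions).

-- the list of positions l, l+1, ..., r   (empty when r < l)
range : ℕ → ℕ → List ℕ
range l r = map (l +_) (upTo (suc r ∸ l))

occ : (ℕ → ℕ) → ℕ → ℕ → ℕ → ℕ
occ S x l r = length (filter (λ i → S i ≟ x) (range l r))

distinct : (ℕ → ℕ) → ℕ → ℕ → ℕ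
distinct S l r = length (deduplicate _≟_ (map S (range l r)))

Occurs : (ℕ → ℕ) → ℕ → ℕ → ℕ → Set
Occurs S x l r = Σ ℕ λ i → (l ≤ i) × (i ≤ r) × (S i ≡ x)

-- α = p / q.  x is an α-minority of S[l..r]:
-- occurs at least once and at most α (r-l+1) times, i.e. occ * q ≤ p * (r-l+1)
IsMinority : (p q : ℕ) → (ℕ → ℕ) → ℕ → ℕ → ℕ → Set
IsMinority p q S x l r = Occurs S x l r × (occ S x l r * q ≤ p * (suc r ∸ l))

bigA : (p q : ℕ) → .{{NonZero p}} → ℕ
bigA p q = suc (q / p)

-- Partition of S[0..n-1] into k contiguous nonempty pieces via boundaries b:
-- b 0 = 0, b k = n, b i < b (i+1); piece i (i < k) is S[b i .. b (i+1) - 1].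
IsPartition : ℕ → ℕ → (ℕ → ℕ) → Set
IsPartition n k b = (b 0 ≡ 0) × (b k ≡ n) × (∀ i → i < k → b i < b (suc i))

pieceStart : (ℕ → ℕ) → ℕ → ℕ
pieceStart b i = b i

pieceEnd : (ℕ → ℕ) → ℕ → ℕ
pieceEnd b i = b (suc i) ∸ 1

Overlaps : (ℕ → ℕ) → ℕ → ℕ → ℕ → Set
Overlaps b i l r = Σ ℕ λ t → (pieceStart b i ≤ t) × (t ≤ pieceEnd b i) × (l ≤ t) × (t ≤ r)

ContainedIn : (ℕ → ℕ) → ℕ → ℕ → ℕ → Set
ContainedIn b i l r = (l ≤ pieceStart b i) × (pieceEnd b i ≤ r)

-- (1) An α-minority of S[l..r] occurs at some position of [l..r]; the piece
-- containing that position overlaps [l..r] and has the minority among its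
-- symbols (this needs nothing about how many pieces are overlapped).
-- (2) Piece i is not the last one, so there are at least two pieces and it has
-- at least A distinct symbols. Distinct symbols occupy disjoint positions, so
-- their occurrence counts in [l..r] add up to at most r-l+1, and the rarest of
-- them occurs at most (r-l+1)/A ≤ α(r-l+1) times, because 1/α < A. It occurs at
-- least once since the piece lies inside [l..r].
module Submission where

open import Defs
open import Data.Nat using (ℕ; zero; suc; _+_; _*_; _∸_; _≤_; _<_; NonZero; z≤n; s≤s; s≤s⁻¹; _≡ᵇ_)
open import Data.Nat.Properties
open import Data.Nat.DivMod using (_/_; m≡m%n+[m/n]*n; m%n<n)
open import Data.Nat.ListAction using (sum)
open import Algebra.Properties.CommutativeSemigroup +-commutativeSemigroup using (interchange)
open import Data.List using (List; []; _∷_; [_]; map; length; filter; upTo; deduplicate)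
open import Data.List.Properties using (length-map; length-upTo; map-cong; filter-accept; filter-reject)
open import Data.List.Relation.Unary.All as All using (All; []; _∷_)
open import Data.List.Relation.Unary.Any using (here; there)
open import Data.List.Relation.Unary.AllPairs using ([]; _∷_)
open import Data.List.Relation.Unary.Unique.Propositional using (Unique)
open import Data.List.Relation.Unary.Unique.DecPropositional.Properties _≟_ using (deduplicate-!)
open import Data.List.Membership.Propositional using (_∈_)
open import Data.List.Membership.Propositional.Properties using (∈-map⁻; ∈-upTo⁻; ∈-deduplicate⁻)
open import Data.Product using (Σ; ∃; _×_; _,_; proj₁)
open import Data.Sum using (_⊎_; [_,_]′)
open import Data.Bool using (true; false)
open import Function using (_∘_)
open import Relation.Nullary using (yes; no; contradiction)
open import Relation.Binary.PropositionalEquality using (_≡_; _≢_; refl; sym; trans; cong; cong₂; subst)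

private
  variable
    A : Set

-- occ S y l r is definitionally occurrences S (range l r) y.
occurrences : (A → ℕ) → List A → ℕ → ℕ
occurrences f xs y = length (filter (λ a → f a ≟ y) xs)

occurrences-∷ : ∀ (f : A → ℕ) a xs y →
                occurrences f (a ∷ xs) y ≡ occurrences f [ a ] y + occurrences f xs y
occurrences-∷ f a xs y with f a ≡ᵇ y
... | true  = refl
... | false = refl

occurrences-singleton-≡ : ∀ (f : A → ℕ) a {y} → f a ≡ y → occurrences f [ a ] y ≡ 1
occurrences-singleton-≡ f a {y} = cong length ∘ filter-accept (λ a → f a ≟ y)

occurrences-singleton-≢ : ∀ (f : A → ℕ) a {y} → f a ≢ y → occurrences f [ a ] y ≡ 0
occurrences-singleton-≢ f a {y} = cong length ∘ filter-reject (λ a → f a ≟ y)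

sum-map-+ : ∀ (g h : A → ℕ) xs → sum (map (λ x → g x + h x) xs) ≡ sum (map g xs) + sum (map h xs)
sum-map-+ g h []       = refl
sum-map-+ g h (x ∷ xs) = trans (cong (g x + h x +_) (sum-map-+ g h xs))
                               (interchange (g x) (h x) (sum (map g xs)) (sum (map h xs)))

sum-map-≡0 : ∀ {g : A → ℕ} {xs} → All (λ x → g x ≡ 0) xs → sum (map g xs) ≡ 0
sum-map-≡0 []           = refl
sum-map-≡0 {g = g} {_ ∷ xs} (gx≡0 ∷ gxs) = trans (cong (_+ sum (map g xs)) gx≡0) (sum-map-≡0 gxs)

sum-occurrences-singleton≤1 : ∀ (f : A → ℕ) a {ys} → Unique ys → sum (map (occurrences f [ a ]) ys) ≤ 1
sum-occurrences-singleton≤1 f a []                    = z≤n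
sum-occurrences-singleton≤1 f a {y ∷ ys} (y∉ys ∷ ys!) with f a ≟ y
... | yes fa≡y = ≤-reflexive (cong₂ _+_ (occurrences-singleton-≡ f a fa≡y)
                                        (sum-map-≡0 (All.map (λ y≢z → occurrences-singleton-≢ f a (y≢z ∘ trans (sym fa≡y))) y∉ys)))
... | no fa≢y = ≤-trans (≤-reflexive (cong (_+ _) (occurrences-singleton-≢ f a fa≢y)))
                        (sum-occurrences-singleton≤1 f a ys!)

-- Double counting: each element of xs is counted for at most one y ∈ ys.
sum-occurrences≤length : ∀ (f : A → ℕ) {ys} → Unique ys → ∀ xs → sum (map (occurrences f xs) ys) ≤ length xs
sum-occurrences≤length f {ys} ys! [] = ≤-reflexive (sum-map-≡0 {g = occurrences f []} {ys} (All.tabulate (λ _ → refl)))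
sum-occurrences≤length f {ys} ys! (a ∷ xs) = begin
  sum (map (occurrences f (a ∷ xs)) ys)
    ≡⟨ cong sum (map-cong (occurrences-∷ f a xs) ys) ⟩
  sum (map (λ y → occurrences f [ a ] y + occurrences f xs y) ys)
    ≡⟨ sum-map-+ (occurrences f [ a ]) (occurrences f xs) ys ⟩
  sum (map (occurrences f [ a ]) ys) + sum (map (occurrences f xs) ys)
    ≤⟨ +-mono-≤ (sum-occurrences-singleton≤1 f a ys!) (sum-occurrences≤length f ys! xs) ⟩
  suc (length xs) ∎
  where open ≤-Reasoning

∃-below-average : ∀ (c : A → ℕ) xs → 1 ≤ length xs → ∃ λ x → x ∈ xs × c x * length xs ≤ sum (map c xs)
∃-below-average c (y ∷ []) _ = y , here refl , ≤-reflexive (trans (*-identityʳ (c y)) (sym (+-identityʳ (c y))))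
∃-below-average c (y ∷ xs@(_ ∷ _)) _ with ∃-below-average c xs (s≤s z≤n)
... | x , x∈xs , cx*∣xs∣≤Σ with c y ≤? c x
...   | yes cy≤cx = y , here refl , ≤-trans (≤-reflexive (*-suc (c y) (length xs)))
                      (+-monoʳ-≤ (c y) (≤-trans (*-monoˡ-≤ (length xs) cy≤cx) cx*∣xs∣≤Σ))
...   | no cy≰cx  = x , there x∈xs , ≤-trans (≤-reflexive (*-suc (c x) (length xs)))
                      (+-mono-≤ (<⇒≤ (≰⇒> cy≰cx)) cx*∣xs∣≤Σ)

length-range : ∀ l r → length (range l r) ≡ suc r ∸ l
length-range l r = trans (length-map (l +_) (upTo (suc r ∸ l))) (length-upTo (suc r ∸ l))

m<o∸n⇒n+m<o : ∀ m n o → m < o ∸ n → n + m < o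
m<o∸n⇒n+m<o m zero    o       m<o   = m<o
m<o∸n⇒n+m<o m (suc n) (suc o) m<o∸n = s≤s (m<o∸n⇒n+m<o m n o m<o∸n)

∈-range⁻ : ∀ {l r i} → i ∈ range l r → l ≤ i × i ≤ r
∈-range⁻ {l} {r} i∈ with ∈-map⁻ (l +_) i∈
... | j , j∈ , refl = m≤m+n l j , s≤s⁻¹ (m<o∸n⇒n+m<o j l (suc r) (∈-upTo⁻ j∈))

-- No monotonicity of the boundaries is needed.
∃-piece-containing : ∀ (b : ℕ → ℕ) k {i} → b 0 ≤ i → i < b k → ∃ λ t → t < k × b t ≤ i × i < b (suc t)
∃-piece-containing b zero    b0≤i i<b0 = contradiction b0≤i (<⇒≱ i<b0)
∃-piece-containing b (suc k) {i} b0≤i i<bk+1 with i <? b k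
... | yes i<bk = let t , t<k , rest = ∃-piece-containing b k b0≤i i<bk in t , m≤n⇒m≤1+n t<k , rest
... | no  i≮bk = k , ≤-refl , ≮⇒≥ i≮bk , i<bk+1

q≤bigA*p : ∀ p q .{{_ : NonZero p}} → q ≤ bigA p q * p
q≤bigA*p p q = ≤-trans (≤-reflexive (m≡m%n+[m/n]*n q p)) (+-monoˡ-≤ (q / p * p) (<⇒≤ (m%n<n q p)))

minority-in-overlapped-piece : ∀ {n k b} → IsPartition n k b → ∀ {S l r} → r < n →
  ∀ {p q x} → IsMinority p q S x l r →
  ∃ λ i → i < k × Overlaps b i l r × Occurs S x (pieceStart b i) (pieceEnd b i)
minority-in-overlapped-piece {k = k} {b} (b0≡0 , bk≡n , _) r<n ((i , l≤i , i≤r , Si≡x) , _)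
  with ∃-piece-containing b k (subst (_≤ i) (sym b0≡0) z≤n) (subst (i <_) (sym bk≡n) (≤-<-trans i≤r r<n))
... | t , t<k , bt≤i , i<bt+1 = t , t<k , (i , bt≤i , i≤e , l≤i , i≤r) , (i , bt≤i , i≤e , Si≡x)
  where
  i≤e : i ≤ pieceEnd b t
  i≤e = subst (i ≤_) (pred[m∸n]≡m∸[1+n] (b (suc t)) 0) (<⇒≤pred i<bt+1)

∃-rare-value : ∀ (f : A → ℕ) xs {ys} → Unique ys → 1 ≤ length ys →
               ∃ λ y → y ∈ ys × occurrences f xs y * length ys ≤ length xs
∃-rare-value f xs {ys} ys! 1≤∣ys∣ with ∃-below-average (occurrences f xs) ys 1≤∣ys∣
... | y , y∈ys , bound = y , y∈ys , ≤-trans bound (sum-occurrences≤length f ys! xs)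

minority-in-contained-block : ∀ p q .{{_ : NonZero p}} S {s e l r} → l ≤ s → e ≤ r →
  bigA p q ≤ distinct S s e → ∃ λ x → Occurs S x s e × IsMinority p q S x l r
minority-in-contained-block p q S {s} {e} {l} {r} l≤s e≤r A≤∣D∣
  with ∃-rare-value S (range l r) (deduplicate-! (map S (range s e))) (≤-trans (s≤s z≤n) A≤∣D∣)
... | x , x∈D , c*∣D∣≤∣range∣ with ∈-map⁻ S (∈-deduplicate⁻ _≟_ (map S (range s e)) x∈D)
... | t , t∈ , refl with ∈-range⁻ t∈
... | s≤t , t≤e = S t , (t , s≤t , t≤e , refl) , (t , ≤-trans l≤s s≤t , ≤-trans t≤e e≤r , refl) , rare
  where
  c = occ S (S t) l r
  L = suc r ∸ l
  rare : c * q ≤ p * L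
  rare = begin
    c * q                             ≤⟨ *-monoʳ-≤ c (q≤bigA*p p q) ⟩
    c * (bigA p q * p)                ≡⟨ *-assoc c (bigA p q) p ⟨
    c * bigA p q * p                  ≤⟨ *-monoˡ-≤ p (*-monoʳ-≤ c A≤∣D∣) ⟩
    c * distinct S s e * p            ≤⟨ *-monoˡ-≤ p c*∣D∣≤∣range∣ ⟩
    length (range l r) * p            ≡⟨ cong (_* p) (length-range l r) ⟩
    L * p                             ≡⟨ *-comm L p ⟩
    p * L                             ∎
    where open ≤-Reasoning

lemma13 : (p q : ℕ) → .{{_ : NonZero p}} → p < q
        → (n : ℕ) (S : ℕ → ℕ) (k : ℕ) (b : ℕ → ℕ)
        → 1 ≤ k → IsPartition n k b
        → (k ≡ 1 ⊎ (∀ i → i < k → (bigA p q ≤ distinct S (pieceStart b i) (pieceEnd b i)) × (distinct S (pieceStart b i) (pieceEnd b i) ≤ 3 * bigA p q)))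
        → (l r : ℕ) → l ≤ r → r < n
        → ((Σ ℕ λ j → j < k × (∀ i → i < k → Overlaps b i l r → i ≡ j ⊎ i ≡ suc j))
            → ∀ x → IsMinority p q S x l r
            → Σ ℕ λ i → i < k × Overlaps b i l r × Occurs S x (pieceStart b i) (pieceEnd b i))
          × (∀ i → suc i < k → ContainedIn b i l r
            → Σ ℕ λ x → Occurs S x (pieceStart b i) (pieceEnd b i) × IsMinority p q S x l r)
lemma13 p q _ n S k b _ partition sizes l r _ r<n =
  (λ _ _ → minority-in-overlapped-piece partition r<n {p} {q}) , contained
  where
  contained : ∀ i → suc i < k → ContainedIn b i l r →
              ∃ λ x → Occurs S x (pieceStart b i) (pieceEnd b i) × IsMinority p q S x l r
  contained i i+1<k (l≤s , e≤r) = minority-in-contained-block p q S l≤s e≤r A≤distinct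
    where
    A≤distinct : bigA p q ≤ distinct S (pieceStart b i) (pieceEnd b i)
    A≤distinct = [ (λ k≡1 → contradiction (subst (suc i <_) k≡1 i+1<k) λ { (s≤s ()) })
                 , (λ many → proj₁ (many i (<-trans (n<1+n i) i+1<k))) ]′ sizes
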